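{- Let $R$ be an integral domain, $p,q\in R$, $m\ge1$ an integer, and let $a=(a_n)_{n\ge0}$ be a linear recurrent sequence over $R$ with characteristic polynomial $(t^2-pt+q)^m$. Then $L^{(-1,p)}(a)$ is a linear recurrent sequence with the same characteristic polynomial $(t^2-pt+q)^m$.
   Context: For a sequence $a=(a_n)_{n\ge0}$ over $R$ and $h,y\in R$, $L^{(h,y)}(a)=b$ with $b_n=\sum_{i=0}^n\binom{n}{i}h^iy^{n-i}a_i$; thus $L^{(-1,p)}(a)_n=\sum_{i=0}^n\binom{n}{i}(-1)^ip^{n-i}a_i$. A sequence has characteristic polynomial $t^d-c_1t^{d-1}-\cdots-c_d$ if $a_n=c_1a_{n-1}+\cdots+c_da_{n-d}$ for all $n\ge d$. -}

module Defs where

open import Level using (_⊔_)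
open import Data.Nat using (ℕ; zero; suc)
open import Data.Nat.Combinatorics using (_C_)
open import Data.List using (List; []; _∷_; length)
open import Data.Sum using (_⊎_)
open import Relation.Nullary using (¬_)
open import Algebra.Bundles using (CommutativeRing)
import Algebra.Definitions.RawSemiring as RS
import Algebra.Bundles
open import Data.Product using (_×_)
open import Data.Nat using () renaming (_∸_ to _∸ℕ_; _+_ to _+ℕ_)

module _ {c ℓ} (R : CommutativeRing c ℓ) where
  open CommutativeRing R
  open RS (Algebra.Bundles.Semiring.rawSemiring semiring) using (_^_) renaming (_×_ to _·ℕ_)

  record IsIntegralDomain : Set (c ⊔ ℓ) where
    field
      1≉0 : ¬ (1# ≈ 0#)
      noZeroDivisors : ∀ x y → x * y ≈ 0# → x ≈ 0# ⊎ y ≈ 0#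

  -- Polynomials over R as coefficient lists in ascending degree:
  -- f₀ ∷ f₁ ∷ … ∷ f_d ∷ []  represents  f₀ + f₁ t + … + f_d t^d.
  Poly : Set c
  Poly = List Carrier

  scalePoly : Carrier → Poly → Poly
  scalePoly x [] = []
  scalePoly x (f ∷ fs) = (x * f) ∷ scalePoly x fs

  addPoly : Poly → Poly → Poly
  addPoly [] g = g
  addPoly (f ∷ fs) [] = f ∷ fs
  addPoly (f ∷ fs) (g ∷ gs) = (f + g) ∷ addPoly fs gs

  mulPoly : Poly → Poly → Poly
  mulPoly [] g = []
  mulPoly (f ∷ fs) g = addPoly (scalePoly f g) (0# ∷ mulPoly fs g)

  powPoly : Poly → ℕ → Poly
  powPoly f zero = 1# ∷ []
  powPoly f (suc m) = mulPoly f (powPoly f m)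

  quadPoly : Carrier → Carrier → Poly
  quadPoly p q = q ∷ (- p) ∷ 1# ∷ []

  evalShift : Poly → (ℕ → Carrier) → ℕ → Carrier
  evalShift [] a k = 0#
  evalShift (f ∷ fs) a k = f * a k + evalShift fs (λ n → a (suc n)) k

  data LastIs (x : Carrier) : Poly → Set (c ⊔ ℓ) where
    last-here  : ∀ {y} → y ≈ x → LastIs x (y ∷ [])
    last-there : ∀ {y fs} → LastIs x fs → LastIs x (y ∷ fs)

  -- The sequence a has characteristic polynomial f = t^d - c₁t^{d-1} - … - c_d
  -- (f monic with coefficient list of length d+1): for all n ≥ d,
  -- a_n = c₁ a_{n-1} + … + c_d a_{n-d}; equivalently (writing n = k + d)
  -- Σ_{j=0}^{d} f_j a_{k+j} = 0 for all k.
  HasCharPoly : Poly → (ℕ → Carrier) → Set (c ⊔ ℓ)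
  HasCharPoly f a = LastIs 1# f × (∀ k → evalShift f a k ≈ 0#)

  sumTo : ℕ → (ℕ → Carrier) → Carrier
  sumTo zero g = g 0
  sumTo (suc n) g = sumTo n g + g (suc n)

  L : Carrier → Carrier → (ℕ → Carrier) → (ℕ → Carrier)
  L h y a n = sumTo n (λ i → ((n C i) ·ℕ ((h ^ i) * (y ^ (n ∸ℕ i))))  * a i)

{-# OPTIONS --safe #-}
-- Write E for the shift of sequences and L for L^{(-1,p)}. Pascal's rule gives
-- L(a)_{n+1} = p L(a)_n - L(Ea)_n, i.e. L ∘ E = (p - E) ∘ L. The substitution
-- t ↦ p - t fixes t² - pt + q, so L commutes with (E² - pE + q)^m and therefore
-- maps the sequences annihilated by it to sequences annihilated by it.
module Submission where

open import Defs
open import Data.Nat using (ℕ; _≥_)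
open import Data.Product using (_×_)
open import Algebra.Bundles using (CommutativeRing)

open import Algebra.Bundles using (Semiring)
open import Level using (_⊔_)
open import Data.Nat using (zero; suc; _∸_; _<_; s≤s) renaming (_+_ to _+ℕ_)
import Data.Nat.Properties as ℕ
open import Data.Nat.Combinatorics using (_C_; nCk+nC[k+1]≡[n+1]C[k+1])
open import Data.Nat.Combinatorics.Specification using (k>n⇒nCk≡0)
open import Data.List using ([]; _∷_)
open import Data.Product using (_,_)
open import Data.Sum using (inj₁; inj₂)
open import Relation.Binary.Core using (_Preserves_⟶_)
import Relation.Binary.PropositionalEquality as ≡
import Relation.Binary.Reasoning.Setoid as SetoidReasoning
import Algebra.Definitions.RawSemiring as RawSemiringDefinitions
import Algebra.Properties.Monoid.Mult as MonoidMult
import Algebra.Properties.Semiring.Mult as SemiringMult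
import Algebra.Properties.Ring as RingProperties
import Algebra.Properties.CommutativeSemigroup as CommutativeSemigroupProperties

module _ {c ℓ} (R : CommutativeRing c ℓ) where
  open CommutativeRing R
  open RawSemiringDefinitions (Semiring.rawSemiring semiring)
    using (_^_) renaming (_×_ to _·ℕ_)
  open MonoidMult +-monoid using (×-homo-+; ×-congʳ)
  open SemiringMult semiring using (×-comm-*)
  open RingProperties ring using (-1*x≈-x; -‿distribˡ-*; ⁻¹-anti-homo‿-)
  open CommutativeSemigroupProperties +-commutativeSemigroup
    using () renaming (interchange to +-interchange; x∙yz≈xz∙y to x+[y+z]≈[x+z]+y)
  open CommutativeSemigroupProperties *-commutativeSemigroup
    using () renaming (x∙yz≈y∙xz to x*[y*z]≈y*[x*z])
  open SetoidReasoning setoid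

  Seq : Set c
  Seq = ℕ → Carrier

  infix 4 _≋_
  _≋_ : Seq → Seq → Set ℓ
  a ≋ b = ∀ n → a n ≈ b n

  shift : Seq → Seq
  shift a n = a (suc n)

  1*x+0≈x : ∀ x → 1# * x + 0# ≈ x
  1*x+0≈x x = trans (+-identityʳ _) (*-identityˡ x)

  evalShift-cong : ∀ f {a b} → a ≋ b → evalShift R f a ≋ evalShift R f b
  evalShift-cong []       a≋b k = refl
  evalShift-cong (x ∷ fs) a≋b k =
    +-cong (*-congˡ (a≋b k)) (evalShift-cong fs (λ n → a≋b (suc n)) k)

  evalShift-shift : ∀ f a k → evalShift R f (shift a) k ≡.≡ evalShift R f a (suc k)
  evalShift-shift []       a k = ≡.refl
  evalShift-shift (x ∷ fs) a k = ≡.cong (x * a (suc k) +_) (evalShift-shift fs (shift a) k)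

  evalShift-addPoly : ∀ f g a k →
    evalShift R (addPoly R f g) a k ≈ evalShift R f a k + evalShift R g a k
  evalShift-addPoly []       g        a k = sym (+-identityˡ _)
  evalShift-addPoly (x ∷ fs) []       a k = sym (+-identityʳ _)
  evalShift-addPoly (x ∷ fs) (y ∷ gs) a k = begin
    (x + y) * a k + evalShift R (addPoly R fs gs) (shift a) k
      ≈⟨ +-cong (distribʳ (a k) x y) (evalShift-addPoly fs gs (shift a) k) ⟩
    (x * a k + y * a k) + (evalShift R fs (shift a) k + evalShift R gs (shift a) k)
      ≈⟨ +-interchange _ _ _ _ ⟩
    (x * a k + evalShift R fs (shift a) k) + (y * a k + evalShift R gs (shift a) k) ∎

  evalShift-scalePoly : ∀ x f a k → evalShift R (scalePoly R x f) a k ≈ x * evalShift R f a k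
  evalShift-scalePoly x []       a k = sym (zeroʳ x)
  evalShift-scalePoly x (y ∷ fs) a k = begin
    x * y * a k + evalShift R (scalePoly R x fs) (shift a) k
      ≈⟨ +-cong (*-assoc x y (a k)) (evalShift-scalePoly x fs (shift a) k) ⟩
    x * (y * a k) + x * evalShift R fs (shift a) k
      ≈⟨ distribˡ x _ _ ⟨
    x * (y * a k + evalShift R fs (shift a) k) ∎

  evalShift-mulPoly : ∀ f g a k →
    evalShift R (mulPoly R f g) a k ≈ evalShift R f (evalShift R g a) k
  evalShift-mulPoly []       g a k = refl
  evalShift-mulPoly (x ∷ fs) g a k = begin
    evalShift R (addPoly R (scalePoly R x g) (0# ∷ mulPoly R fs g)) a k
      ≈⟨ evalShift-addPoly (scalePoly R x g) (0# ∷ mulPoly R fs g) a k ⟩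
    evalShift R (scalePoly R x g) a k + (0# * a k + evalShift R (mulPoly R fs g) (shift a) k)
      ≈⟨ +-cong (evalShift-scalePoly x g a k) (trans (+-congʳ (zeroˡ (a k))) (+-identityˡ _)) ⟩
    x * evalShift R g a k + evalShift R (mulPoly R fs g) (shift a) k
      ≈⟨ +-congˡ (evalShift-mulPoly fs g (shift a) k) ⟩
    x * evalShift R g a k + evalShift R fs (evalShift R g (shift a)) k
      ≈⟨ +-congˡ (evalShift-cong fs (λ n → reflexive (evalShift-shift g a n)) k) ⟩
    x * evalShift R g a k + evalShift R fs (shift (evalShift R g a)) k ∎

  Commutes : (Seq → Seq) → Poly R → Set (c ⊔ ℓ)
  Commutes T f = ∀ a → evalShift R f (T a) ≋ T (evalShift R f a)

  commutes-powPoly : ∀ {T f} → T Preserves _≋_ ⟶ _≋_ → Commutes T f →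
                     ∀ m → Commutes T (powPoly R f m)
  commutes-powPoly {T} T-cong T∘f zero a k = begin
    1# * T a k + 0#           ≈⟨ 1*x+0≈x (T a k) ⟩
    T a k                     ≈⟨ T-cong (λ n → sym (1*x+0≈x (a n))) k ⟩
    T (λ n → 1# * a n + 0#) k ∎
  commutes-powPoly {T} {f} T-cong T∘f (suc m) a k = begin
    evalShift R (mulPoly R f fᵐ) (T a) k
      ≈⟨ evalShift-mulPoly f fᵐ (T a) k ⟩
    evalShift R f (evalShift R fᵐ (T a)) k
      ≈⟨ evalShift-cong f (commutes-powPoly T-cong T∘f m a) k ⟩
    evalShift R f (T (evalShift R fᵐ a)) k
      ≈⟨ T∘f (evalShift R fᵐ a) k ⟩
    T (evalShift R f (evalShift R fᵐ a)) k
      ≈⟨ T-cong (λ n → evalShift-mulPoly f fᵐ a n) k ⟨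
    T (evalShift R (mulPoly R f fᵐ) a) k ∎
    where
    fᵐ : Poly R
    fᵐ = powPoly R f m

  HasCharPoly-map : ∀ {T f a} → T Preserves _≋_ ⟶ _≋_ → T (λ _ → 0#) ≋ (λ _ → 0#) →
                    Commutes T f → HasCharPoly R f a → HasCharPoly R f (T a)
  HasCharPoly-map {T} {f} {a} T-cong T-0 T∘f (monic , annihilated) = monic , λ k → begin
    evalShift R f (T a) k ≈⟨ T∘f a k ⟩
    T (evalShift R f a) k ≈⟨ T-cong annihilated k ⟩
    T (λ _ → 0#) k        ≈⟨ T-0 k ⟩
    0#                    ∎

  sumTo-cong : ∀ n {f g} → f ≋ g → sumTo R n f ≈ sumTo R n g
  sumTo-cong zero    f≋g = f≋g 0
  sumTo-cong (suc n) f≋g = +-cong (sumTo-cong n f≋g) (f≋g (suc n))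

  sumTo-cons : ∀ n f → sumTo R (suc n) f ≈ f 0 + sumTo R n (shift f)
  sumTo-cons zero    f = refl
  sumTo-cons (suc n) f = trans (+-congʳ (sumTo-cons n f)) (+-assoc _ _ _)

  sumTo-+ : ∀ n f g → sumTo R n (λ i → f i + g i) ≈ sumTo R n f + sumTo R n g
  sumTo-+ zero    f g = refl
  sumTo-+ (suc n) f g = trans (+-congʳ (sumTo-+ n f g)) (+-interchange _ _ _ _)

  sumTo-*ˡ : ∀ n x f → sumTo R n (λ i → x * f i) ≈ x * sumTo R n f
  sumTo-*ˡ zero    x f = refl
  sumTo-*ˡ (suc n) x f = trans (+-congʳ (sumTo-*ˡ n x f)) (sym (distribˡ x _ _))

  sumTo-0 : ∀ n → sumTo R n (λ _ → 0#) ≈ 0#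
  sumTo-0 zero    = refl
  sumTo-0 (suc n) = trans (+-identityʳ _) (sumTo-0 n)

  module Binomial (h y : Carrier) where

    coeff : ℕ → ℕ → Carrier
    coeff n i = (n C i) ·ℕ (h ^ i * y ^ (n ∸ i))

    coeff-zero : ∀ n → coeff (suc n) 0 ≈ y * coeff n 0
    coeff-zero n = begin
      1# * y ^ suc n + 0#  ≈⟨ 1*x+0≈x _ ⟩
      y * y ^ n            ≈⟨ *-congˡ (1*x+0≈x _) ⟨
      y * (1# * y ^ n + 0#) ∎

    nCk·x≈0 : ∀ {n k} → n < k → ∀ x → (n C k) ·ℕ x ≈ 0#
    nCk·x≈0 n<k x = reflexive (≡.cong (_·ℕ x) (k>n⇒nCk≡0 n<k))

    coeff-pascal : ∀ n i → coeff (suc n) (suc i) ≈ h * coeff n i + y * coeff n (suc i)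
    coeff-pascal n i = begin
      (suc n C suc i) ·ℕ X
        ≈⟨ reflexive (≡.cong (_·ℕ X) (nCk+nC[k+1]≡[n+1]C[k+1] n i)) ⟨
      ((n C i) +ℕ (n C suc i)) ·ℕ X
        ≈⟨ ×-homo-+ X (n C i) (n C suc i) ⟩
      (n C i) ·ℕ (h * h ^ i * y ^ (n ∸ i)) + (n C suc i) ·ℕ X
        ≈⟨ +-congʳ (×-congʳ (n C i) (*-assoc h _ _)) ⟩
      (n C i) ·ℕ (h * (h ^ i * y ^ (n ∸ i))) + (n C suc i) ·ℕ X
        ≈⟨ +-cong (sym (×-comm-* (n C i) h _)) upper ⟩
      h * coeff n i + y * coeff n (suc i) ∎
      where
      X : Carrier
      X = h ^ suc i * y ^ (n ∸ i)

      upper : (n C suc i) ·ℕ X ≈ y * coeff n (suc i)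
      upper with ℕ.<-≤-connex i n
      ... | inj₁ i<n = begin
        (n C suc i) ·ℕ (h ^ suc i * y ^ (n ∸ i))
          ≈⟨ reflexive (≡.cong (λ e → (n C suc i) ·ℕ (h ^ suc i * y ^ e)) (ℕ.+-∸-assoc 1 i<n)) ⟩
        (n C suc i) ·ℕ (h ^ suc i * (y * y ^ (n ∸ suc i)))
          ≈⟨ ×-congʳ (n C suc i) (x*[y*z]≈y*[x*z] _ y _) ⟩
        (n C suc i) ·ℕ (y * (h ^ suc i * y ^ (n ∸ suc i)))
          ≈⟨ ×-comm-* (n C suc i) y _ ⟨
        y * coeff n (suc i) ∎
      ... | inj₂ n≤i = begin
        (n C suc i) ·ℕ X     ≈⟨ nCk·x≈0 (s≤s n≤i) X ⟩
        0#                   ≈⟨ zeroʳ y ⟨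
        y * 0#               ≈⟨ *-congˡ (nCk·x≈0 (s≤s n≤i) _) ⟨
        y * coeff n (suc i)  ∎

    L-cong : L R h y Preserves _≋_ ⟶ _≋_
    L-cong a≋b n = sumTo-cong n (λ i → *-congˡ (a≋b i))

    L-linear : ∀ x u v → L R h y (λ i → x * u i + v i) ≋ (λ n → x * L R h y u n + L R h y v n)
    L-linear x u v n = begin
      sumTo R n (λ i → coeff n i * (x * u i + v i))
        ≈⟨ sumTo-cong n (λ i → distribute (coeff n i) (u i) (v i)) ⟩
      sumTo R n (λ i → x * (coeff n i * u i) + coeff n i * v i)
        ≈⟨ sumTo-+ n _ _ ⟩
      sumTo R n (λ i → x * (coeff n i * u i)) + L R h y v n
        ≈⟨ +-congʳ (sumTo-*ˡ n x _) ⟩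
      x * L R h y u n + L R h y v n ∎
      where
      distribute : ∀ W U V → W * (x * U + V) ≈ x * (W * U) + W * V
      distribute W U V = trans (distribˡ W _ _) (+-congʳ (x*[y*z]≈y*[x*z] W x U))

    L-0 : L R h y (λ _ → 0#) ≋ (λ _ → 0#)
    L-0 n = trans (sumTo-cong n (λ i → zeroʳ (coeff n i))) (sumTo-0 n)

    L-extend : ∀ a n → sumTo R (suc n) (λ i → coeff n i * a i) ≈ L R h y a n
    L-extend a n = begin
      L R h y a n + coeff n (suc n) * a (suc n)
        ≈⟨ +-congˡ (trans (*-congʳ (nCk·x≈0 (ℕ.n<1+n n) _)) (zeroˡ _)) ⟩
      L R h y a n + 0#
        ≈⟨ +-identityʳ _ ⟩
      L R h y a n ∎

    L-suc : ∀ a n → L R h y a (suc n) ≈ y * L R h y a n + h * L R h y (shift a) n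
    L-suc a n = begin
      sumTo R (suc n) (λ i → coeff (suc n) i * a i)
        ≈⟨ sumTo-cons n _ ⟩
      coeff (suc n) 0 * a 0 + sumTo R n (λ i → coeff (suc n) (suc i) * a (suc i))
        ≈⟨ +-cong (*-congʳ (coeff-zero n)) (sumTo-cong n (λ i → *-congʳ (coeff-pascal n i))) ⟩
      y * coeff n 0 * a 0 + sumTo R n (λ i → (h * coeff n i + y * coeff n (suc i)) * a (suc i))
        ≈⟨ +-congˡ (sumTo-cong n (λ i → distribute (coeff n i) (coeff n (suc i)) (a (suc i)))) ⟩
      y * coeff n 0 * a 0
        + sumTo R n (λ i → h * (coeff n i * a (suc i)) + y * (coeff n (suc i) * a (suc i)))
        ≈⟨ +-congˡ (trans (sumTo-+ n _ _) (+-cong (sumTo-*ˡ n h _) (sumTo-*ˡ n y _))) ⟩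
      y * coeff n 0 * a 0 + (h * L R h y (shift a) n + y * Tail)
        ≈⟨ +-congʳ (*-assoc y _ _) ⟩
      y * (coeff n 0 * a 0) + (h * L R h y (shift a) n + y * Tail)
        ≈⟨ x+[y+z]≈[x+z]+y _ _ _ ⟩
      (y * (coeff n 0 * a 0) + y * Tail) + h * L R h y (shift a) n
        ≈⟨ +-congʳ (distribˡ y _ _) ⟨
      y * (coeff n 0 * a 0 + Tail) + h * L R h y (shift a) n
        ≈⟨ +-congʳ (*-congˡ (trans (sym (sumTo-cons n _)) (L-extend a n))) ⟩
      y * L R h y a n + h * L R h y (shift a) n ∎
      where
      Tail : Carrier
      Tail = sumTo R n (λ i → coeff n (suc i) * a (suc i))

      distribute : ∀ A B U → (h * A + y * B) * U ≈ h * (A * U) + y * (B * U)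
      distribute A B U = trans (distribʳ U _ _) (+-cong (*-assoc h A U) (*-assoc y B U))

  L⁻¹-suc : ∀ p a n → L R (- 1#) p a (suc n) ≈ p * L R (- 1#) p a n - L R (- 1#) p (shift a) n
  L⁻¹-suc p a n = trans (Binomial.L-suc (- 1#) p a n) (+-congˡ (-1*x≈-x _))

  -x*y+[x*y-z]≈-z : ∀ x y z → - x * y + (x * y - z) ≈ - z
  -x*y+[x*y-z]≈-z x y z = begin
    - x * y + (x * y - z)    ≈⟨ +-congʳ (-‿distribˡ-* x y) ⟨
    - (x * y) + (x * y - z)  ≈⟨ +-assoc _ _ _ ⟨
    (- (x * y) + x * y) - z  ≈⟨ +-congʳ (-‿inverseˡ _) ⟩
    0# - z                   ≈⟨ +-identityˡ _ ⟩
    - z                      ∎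

  -[x*y-z]≈-x*y+z : ∀ x y z → - (x * y - z) ≈ - x * y + z
  -[x*y-z]≈-x*y+z x y z = begin
    - (x * y - z)   ≈⟨ ⁻¹-anti-homo‿- (x * y) z ⟩
    z - x * y       ≈⟨ +-comm z _ ⟩
    - (x * y) + z   ≈⟨ +-congʳ (-‿distribˡ-* x y) ⟩
    - x * y + z     ∎

  commutes-quadPoly : ∀ p q → Commutes (L R (- 1#) p) (quadPoly R p q)
  commutes-quadPoly p q a k = begin
    q * b k + (- p * b (suc k) + (1# * b (suc (suc k)) + 0#))
      ≈⟨ +-congˡ (+-congˡ (1*x+0≈x _)) ⟩
    q * b k + (- p * b (suc k) + b (suc (suc k)))
      ≈⟨ +-congˡ (+-congˡ (L⁻¹-suc p a (suc k))) ⟩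
    q * b k + (- p * b (suc k) + (p * b (suc k) - b′ (suc k)))
      ≈⟨ +-congˡ (-x*y+[x*y-z]≈-z p (b (suc k)) (b′ (suc k))) ⟩
    q * b k + - b′ (suc k)
      ≈⟨ +-congˡ (-‿cong (L⁻¹-suc p (shift a) k)) ⟩
    q * b k + - (p * b′ k - b″ k)
      ≈⟨ +-congˡ (-[x*y-z]≈-x*y+z p (b′ k) (b″ k)) ⟩
    q * b k + (- p * b′ k + b″ k)
      ≈⟨ +-congˡ (+-congˡ (1*x+0≈x _)) ⟨
    q * b k + (- p * b′ k + (1# * b″ k + 0#))
      ≈⟨ +-congˡ (+-congˡ (+-congˡ (L-0 k))) ⟨
    q * b k + (- p * b′ k + (1# * b″ k + Lₚ (λ _ → 0#) k))
      ≈⟨ +-congˡ (+-congˡ (L-linear 1# _ _ k)) ⟨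
    q * b k + (- p * b′ k + Lₚ (λ n → 1# * a (suc (suc n)) + 0#) k)
      ≈⟨ +-congˡ (L-linear (- p) _ _ k) ⟨
    q * b k + Lₚ (λ n → - p * a (suc n) + (1# * a (suc (suc n)) + 0#)) k
      ≈⟨ L-linear q _ _ k ⟨
    Lₚ (evalShift R (quadPoly R p q) a) k ∎
    where
    open Binomial (- 1#) p using (L-linear; L-0)

    Lₚ : Seq → Seq
    Lₚ = L R (- 1#) p

    b b′ b″ : Seq
    b  = Lₚ a
    b′ = Lₚ (shift a)
    b″ = Lₚ (shift (shift a))

  HasCharPoly-L-powPoly-quadPoly : ∀ p q m a →
    HasCharPoly R (powPoly R (quadPoly R p q) m) a →
    HasCharPoly R (powPoly R (quadPoly R p q) m) (L R (- 1#) p a)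
  HasCharPoly-L-powPoly-quadPoly p q m a =
    HasCharPoly-map L-cong L-0 (commutes-powPoly L-cong (commutes-quadPoly p q) m)
    where open Binomial (- 1#) p using (L-cong; L-0)

-- The result holds in every commutative ring and for every m.
corollary13 : ∀ {c ℓ} (R : CommutativeRing c ℓ) → IsIntegralDomain R →
    (p q : CommutativeRing.Carrier R) (m : ℕ) → m ≥ 1 →
    (a : ℕ → CommutativeRing.Carrier R) →
    HasCharPoly R (powPoly R (quadPoly R p q) m) a →
    HasCharPoly R (powPoly R (quadPoly R p q) m)
      (L R (CommutativeRing.-_ R (CommutativeRing.1# R)) p a)
corollary13 R _ p q m _ = HasCharPoly-L-powPoly-quadPoly R p q m
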